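{- Let $d,r,s\in\mathbb{F}_q[t]\setminus\{0\}$ and $b\in\mathbb{F}_q[t]$ with $(b,r)=1$. Then \[ \#\{a\in\mathbb{F}_q[t]/(s):\mathrm{denom}(a/s+b/r)=d\}\le\frac{\langle d\rangle\langle(r,s)\rangle}{\langle r\rangle}. \]
   Context: $\langle g\rangle=q^{\deg g}$ for polynomials $g$; $(r,s)$ is the monic gcd. For $\lambda\in\mathbb{F}_q(t)/\mathbb{F}_q[t]$, $\mathrm{denom}(\lambda)$ is the monic denominator of $\lambda$ in lowest terms. -}

module Defs where

open import Level using (0ℓ)
open import Data.Nat as ℕ using (ℕ; _∸_; _^_)
open import Data.List using (List; []; _∷_; length; map; last)
open import Data.Maybe using (just)
open import Data.Product using (∃; Σ; _×_; _,_)
open import Relation.Nullary using (¬_; yes; no)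
open import Relation.Binary.Definitions using (DecidableEquality)
open import Relation.Binary.PropositionalEquality using (_≡_; _≢_)
open import Algebra.Structures using (IsCommutativeRing)
open import Data.List.Membership.Propositional using (_∈_)
open import Data.List.Relation.Unary.Unique.Propositional using (Unique)

record FiniteField : Set₁ where
  field
    Carrier           : Set
    _+_ _*_           : Carrier → Carrier → Carrier
    -_                : Carrier → Carrier
    0# 1#             : Carrier
    isCommutativeRing : IsCommutativeRing _≡_ _+_ _*_ -_ 0# 1#
    0≢1               : 0# ≢ 1#
    inverse           : ∀ x → x ≢ 0# → ∃ λ y → x * y ≡ 1#
    _≟_               : DecidableEquality Carrier
    elements          : List Carrier
    complete          : ∀ x → x ∈ elements
    unique            : Unique elements

  q : ℕ
  q = length elements

-- Polynomials F_q[t] as coefficient lists (constant term first),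
-- identified up to trailing zeros.
module Poly (F : FiniteField) where
  open FiniteField F renaming (_+_ to _+ᶠ_; _*_ to _*ᶠ_; -_ to -ᶠ_)

  Pol : Set
  Pol = List Carrier

  norm : Pol → Pol
  norm [] = []
  norm (x ∷ xs) with norm xs
  ... | y ∷ ys = x ∷ y ∷ ys
  ... | [] with x ≟ 0#
  ...   | yes _ = []
  ...   | no  _ = x ∷ []

  _≈_ : Pol → Pol → Set
  p ≈ p' = norm p ≡ norm p'

  NonZeroP : Pol → Set
  NonZeroP p = ¬ (norm p ≡ [])

  deg : Pol → ℕ
  deg p = length (norm p) ∸ 1

  ⟨_⟩ : Pol → ℕ
  ⟨ g ⟩ = q ^ deg g

  Monic : Pol → Set
  Monic p = last (norm p) ≡ just 1#

  one : Pol
  one = 1# ∷ []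

  _+_ : Pol → Pol → Pol
  [] + p' = p'
  (x ∷ p) + [] = x ∷ p
  (x ∷ p) + (y ∷ p') = (x +ᶠ y) ∷ (p + p')

  -_ : Pol → Pol
  - p = map -ᶠ_ p

  _-_ : Pol → Pol → Pol
  p - p' = p + (- p')

  _*_ : Pol → Pol → Pol
  [] * p' = []
  (x ∷ p) * p' = map (x *ᶠ_) p' + (0# ∷ (p * p'))

  infixl 7 _*_
  infixl 6 _+_ _-_

  _∣_ : Pol → Pol → Set
  e ∣ f = ∃ λ h → (e * h) ≈ f

  IsMonicGCD : Pol → Pol → Pol → Set
  IsMonicGCD f f' g = Monic g × g ∣ f × g ∣ f' × (∀ e → e ∣ f → e ∣ f' → e ∣ g)

  -- Denom n m d : d = denom(n/m), the monic denominator of n/m ∈ F_q(t)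
  -- (equivalently of its class in F_q(t)/F_q[t]) written in lowest terms:
  -- n/m = u/d with d monic and (u , d) = 1.
  Denom : Pol → Pol → Pol → Set
  Denom n m d = Monic d × Σ Pol (λ u → (u * m) ≈ (n * d) × IsMonicGCD u d one)

{-# OPTIONS --safe #-}
module Submission where

-- Fix a₀ in the list, with a₀/s + b/r = u₀/d, and write h for a greatest common
-- divisor of s and d, s = h s₁, d = h d₁.  For any other a in the list, with
-- a/s + b/r = u/d, subtracting gives s₁ (u - u₀) = d₁ (a - a₀); since s₁ and d₁
-- are coprime, a ≡ a₀ (mod s₁).  The list is pairwise incongruent modulo s, and
-- a = a₀ + s₁ w is determined modulo s by w modulo h, so its length is at most
-- ⟨h⟩.  On the other hand, clearing denominators in the equation for a₀ shows
-- r ∣ b s d₁, hence r ∣ s d₁ as (b, r) = 1; writing g = x r + y s then gives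
-- r h ∣ d g, so ⟨h⟩ ⟨r⟩ ≤ ⟨d⟩ ⟨g⟩.

open import Defs
open import Data.Nat using (_≤_) renaming (_*_ to _*ℕ_)
open import Data.List using (List; length)
open import Data.List.Relation.Unary.All using (All)
open import Data.List.Relation.Unary.AllPairs using (AllPairs)
open import Relation.Nullary using (¬_)

open import Level using (0ℓ)
open import Algebra.Bundles using (CommutativeRing)
open import Algebra.Solver.Ring.AlmostCommutativeRing
  using (fromCommutativeRing; _-Raw-AlmostCommutative⟶_)
open import Data.Empty using (⊥-elim)
open import Data.Fin using (Fin)
import Data.Fin.Base as Fin
import Data.Fin.Properties as Fin
open import Data.Integer as ℤ using (ℤ; +_; -[1+_]; _⊖_; _◃_)
import Data.Integer.Properties as ℤ
open import Data.List using ([]; _∷_; map)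
import Data.List as List
import Data.List.Properties as List
open import Data.List.Relation.Unary.All using ([]; _∷_)
import Data.List.Relation.Unary.All as All
open import Data.List.Relation.Unary.AllPairs using ([]; _∷_)
open import Data.List.Relation.Unary.Any using (index)
open import Data.List.Relation.Unary.Any.Properties using (lookup-index)
open import Data.Maybe using (Maybe; just; nothing)
open import Data.Nat as ℕ using (ℕ; zero; suc; z≤n; s≤s; _^_)
import Data.Nat.Properties as ℕ
open import Data.Product using (_,_; proj₁)
import Data.Sign as Sign
open import Data.Sum using (_⊎_; inj₁; inj₂)
import Data.Vec as Vec
import Data.Vec.Relation.Unary.All.Properties as VecAll
import Data.Vec.Relation.Unary.AllPairs as VecAllPairs
open import Data.Vec.Relation.Unary.Unique.Propositional.Properties using (lookup-injective)
open import Function using (_∘_; case_of_)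
open import Relation.Binary.Bundles using (Setoid)
open import Relation.Binary.Definitions using (tri<; tri≈; tri>)
import Relation.Binary.PropositionalEquality as ≡
open ≡ using (_≡_; _≢_)
import Relation.Binary.Reasoning.Setoid
open import Relation.Nullary using (yes; no)

-- Algebra.Solver.Ring proves an identity by comparing normal forms up to
-- definitional equality, so their coefficients must compute: they are taken in
-- ℤ and mapped into R.
module IntegerCoefficientSolver (R : CommutativeRing 0ℓ 0ℓ) where
  open CommutativeRing R
  open import Algebra.Properties.Semiring.Mult semiring using (_×_; ×-homo-+; ×1-homo-*)
  open import Algebra.Properties.Ring ring using (-‿distribˡ-*; -‿distribʳ-*)
  open import Algebra.Properties.AbelianGroup +-abelianGroup using (⁻¹-∙-comm; xyx⁻¹≈y)
  open import Algebra.Properties.Group +-group using (ε⁻¹≈ε; ⁻¹-involutive)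
  open import Relation.Binary.Reasoning.Setoid setoid

  fromℤ : ℤ → Carrier
  fromℤ (+ n)    = n × 1#
  fromℤ -[1+ n ] = - (suc n × 1#)

  fromℤ-+◃ : ∀ n → fromℤ (Sign.+ ◃ n) ≈ n × 1#
  fromℤ-+◃ zero    = refl
  fromℤ-+◃ (suc n) = refl

  fromℤ--◃ : ∀ n → fromℤ (Sign.- ◃ n) ≈ - (n × 1#)
  fromℤ--◃ zero    = sym ε⁻¹≈ε
  fromℤ--◃ (suc n) = refl

  fromℤ-⊖ : ∀ m n → fromℤ (m ⊖ n) ≈ m × 1# - n × 1#
  fromℤ-⊖ zero    zero    = sym (trans (+-congˡ ε⁻¹≈ε) (+-identityʳ 0#))
  fromℤ-⊖ zero    (suc n) = sym (+-identityˡ _)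
  fromℤ-⊖ (suc m) zero    = sym (trans (+-congˡ ε⁻¹≈ε) (+-identityʳ _))
  fromℤ-⊖ (suc m) (suc n) = begin
    fromℤ (suc m ⊖ suc n)      ≡⟨ ≡.cong fromℤ (ℤ.[1+m]⊖[1+n]≡m⊖n m n) ⟩
    fromℤ (m ⊖ n)              ≈⟨ fromℤ-⊖ m n ⟩
    M - N                      ≈⟨ +-congʳ (xyx⁻¹≈y 1# M) ⟨
    1# + M + - 1# + - N        ≈⟨ +-assoc _ _ _ ⟩
    (1# + M) + (- 1# + - N)    ≈⟨ +-congˡ (⁻¹-∙-comm 1# N) ⟩
    (1# + M) - (1# + N)        ∎
    where M = m × 1#; N = n × 1#

  +-homo : ∀ i j → fromℤ (i ℤ.+ j) ≈ fromℤ i + fromℤ j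
  +-homo (+ m)    (+ n)    = ×-homo-+ 1# m n
  +-homo (+ m)    -[1+ n ] = fromℤ-⊖ m (suc n)
  +-homo -[1+ m ] (+ n)    = trans (fromℤ-⊖ n (suc m)) (+-comm _ _)
  +-homo -[1+ m ] -[1+ n ] = begin
    - (suc (suc (m ℕ.+ n)) × 1#)       ≡⟨ ≡.cong (λ k → - (suc k × 1#)) (ℕ.+-suc m n) ⟨
    - ((suc m ℕ.+ suc n) × 1#)         ≈⟨ -‿cong (×-homo-+ 1# (suc m) (suc n)) ⟩
    - (suc m × 1# + suc n × 1#)        ≈⟨ ⁻¹-∙-comm _ _ ⟨
    - (suc m × 1#) + - (suc n × 1#)    ∎

  *-homo : ∀ i j → fromℤ (i ℤ.* j) ≈ fromℤ i * fromℤ j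
  *-homo (+ m)    (+ n)    = trans (fromℤ-+◃ (m ℕ.* n)) (×1-homo-* m n)
  *-homo (+ m)    -[1+ n ] =
    trans (fromℤ--◃ (m ℕ.* suc n)) (trans (-‿cong (×1-homo-* m (suc n))) (-‿distribʳ-* _ _))
  *-homo -[1+ m ] (+ n)    =
    trans (fromℤ--◃ (suc m ℕ.* n)) (trans (-‿cong (×1-homo-* (suc m) n)) (-‿distribˡ-* _ _))
  *-homo -[1+ m ] -[1+ n ] = begin
    fromℤ (Sign.+ ◃ (suc m ℕ.* suc n))  ≈⟨ fromℤ-+◃ (suc m ℕ.* suc n) ⟩
    (suc m ℕ.* suc n) × 1#              ≈⟨ ×1-homo-* (suc m) (suc n) ⟩
    M * N                               ≈⟨ ⁻¹-involutive (M * N) ⟨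
    - - (M * N)                         ≈⟨ -‿cong (-‿distribʳ-* M N) ⟩
    - (M * - N)                         ≈⟨ -‿distribˡ-* M (- N) ⟩
    - M * - N                           ∎
    where M = suc m × 1#; N = suc n × 1#

  -‿homo : ∀ i → fromℤ (ℤ.- i) ≈ - fromℤ i
  -‿homo (+ zero)  = sym ε⁻¹≈ε
  -‿homo (+ suc n) = refl
  -‿homo -[1+ n ]  = sym (⁻¹-involutive _)

  ℤ-homomorphism : ℤ.+-*-rawRing -Raw-AlmostCommutative⟶ fromCommutativeRing R
  ℤ-homomorphism = record
    { ⟦_⟧ = fromℤ ; +-homo = +-homo ; *-homo = *-homo ; -‿homo = -‿homo
    ; 0-homo = refl ; 1-homo = +-identityʳ 1# }

  _≟ℤ_ : ∀ i j → Maybe (fromℤ i ≈ fromℤ j)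
  i ≟ℤ j with i ℤ.≟ j
  ... | yes ≡.refl = just refl
  ... | no _       = nothing

  open import Algebra.Solver.Ring ℤ.+-*-rawRing (fromCommutativeRing R) ℤ-homomorphism _≟ℤ_ public

AllPairs-fromList⁺ : ∀ {A : Set} {R : A → A → Set} {xs : List A} →
                     AllPairs R xs → VecAllPairs.AllPairs R (Vec.fromList xs)
AllPairs-fromList⁺ []         = VecAllPairs.[]
AllPairs-fromList⁺ (rx ∷ rxs) = VecAll.fromList⁺ rx VecAllPairs.∷ AllPairs-fromList⁺ rxs

distinct-length≤ : ∀ {m} {ys : List (Fin m)} → AllPairs _≢_ ys → length ys ≤ m
distinct-length≤ distinct =
  Fin.injective⇒≤ (λ {i} {j} → lookup-injective (AllPairs-fromList⁺ distinct) i j)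

module _ {A : Set} {P : A → Set} {R : A → A → Set} {m : ℕ}
         (code : ∀ {a} → P a → Fin m)
         (code-separates : ∀ {a a'} (pa : P a) (pa' : P a') → code pa ≡ code pa' → ¬ R a a') where

  private
    codes : ∀ {xs} → All P xs → List (Fin m)
    codes []         = []
    codes (pa ∷ pas) = code pa ∷ codes pas

    length-codes : ∀ {xs} (pas : All P xs) → length (codes pas) ≡ length xs
    length-codes []         = ≡.refl
    length-codes (pa ∷ pas) = ≡.cong suc (length-codes pas)

    codes-distinct : ∀ {xs} (pas : All P xs) → AllPairs R xs → AllPairs _≢_ (codes pas)
    codes-distinct []         []         = []
    codes-distinct (pa ∷ pas) (rs ∷ rss) = distinct-from pas rs ∷ codes-distinct pas rss
      where
      distinct-from : ∀ {ys} (pys : All P ys) → All (R _) ys → All (code pa ≢_) (codes pys)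
      distinct-from []         []        = []
      distinct-from (pb ∷ pys) (r ∷ rs') = (λ eq → code-separates pa pb eq r) ∷ distinct-from pys rs'

  separated-length≤ : ∀ {xs} → All P xs → AllPairs R xs → length xs ≤ m
  separated-length≤ pas rs =
    ≡.subst (_≤ m) (length-codes pas) (distinct-length≤ (codes-distinct pas rs))

module FqPolynomials (F : FiniteField) where
  open import Data.Product using (∃; ∃₂; _×_; proj₂)
  open FiniteField F renaming (_+_ to infixl 6 _+ᶠ_; _*_ to infixl 7 _*ᶠ_; -_ to infix 8 -ᶠ_)
  open Poly F
  open ≡ using (refl; sym; trans; cong; cong₂)

  𝔽 : CommutativeRing 0ℓ 0ℓ
  𝔽 = record
    { _≈_ = _≡_ ; _+_ = _+ᶠ_ ; _*_ = _*ᶠ_ ; -_ = -ᶠ_ ; 0# = 0# ; 1# = 1#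
    ; isCommutativeRing = isCommutativeRing }

  module 𝔽 = CommutativeRing 𝔽

  *-≢0 : ∀ {x y} → x ≢ 0# → y ≢ 0# → x *ᶠ y ≢ 0#
  *-≢0 {x} {y} x≢0 y≢0 xy≡0 with inverse x x≢0
  ... | x⁻¹ , xx⁻¹≡1 = y≢0 (begin
    y                   ≡⟨ 𝔽.*-identityˡ y ⟨
    1# *ᶠ y             ≡⟨ cong (_*ᶠ y) xx⁻¹≡1 ⟨
    x *ᶠ x⁻¹ *ᶠ y       ≡⟨ cong (_*ᶠ y) (𝔽.*-comm x x⁻¹) ⟩
    x⁻¹ *ᶠ x *ᶠ y       ≡⟨ 𝔽.*-assoc x⁻¹ x y ⟩
    x⁻¹ *ᶠ (x *ᶠ y)     ≡⟨ cong (x⁻¹ *ᶠ_) xy≡0 ⟩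
    x⁻¹ *ᶠ 0#           ≡⟨ 𝔽.zeroʳ x⁻¹ ⟩
    0#                  ∎)
    where open ≡.≡-Reasoning

  q-nonZero : ℕ.NonZero q
  q-nonZero with elements | complete 0#
  ... | _ ∷ _ | _ = _

  coeff : Pol → ℕ → Carrier
  coeff []      _       = 0#
  coeff (x ∷ p) zero    = x
  coeff (x ∷ p) (suc i) = coeff p i

  infixr 8 _·_
  _·_ : Carrier → Pol → Pol
  x · p = map (x *ᶠ_) p

  coeff-+ : ∀ p p' i → coeff (p + p') i ≡ coeff p i +ᶠ coeff p' i
  coeff-+ []      p'       i       = sym (𝔽.+-identityˡ _)
  coeff-+ (x ∷ p) []       zero    = sym (𝔽.+-identityʳ x)
  coeff-+ (x ∷ p) []       (suc i) = sym (𝔽.+-identityʳ _)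
  coeff-+ (x ∷ p) (y ∷ p') zero    = refl
  coeff-+ (x ∷ p) (y ∷ p') (suc i) = coeff-+ p p' i

  coeff-neg : ∀ p i → coeff (- p) i ≡ -ᶠ coeff p i
  coeff-neg []      i       = sym ε⁻¹≈ε
    where open import Algebra.Properties.Group 𝔽.+-group using (ε⁻¹≈ε)
  coeff-neg (x ∷ p) zero    = refl
  coeff-neg (x ∷ p) (suc i) = coeff-neg p i

  coeff-· : ∀ x p i → coeff (x · p) i ≡ x *ᶠ coeff p i
  coeff-· x []      i       = sym (𝔽.zeroʳ x)
  coeff-· x (y ∷ p) zero    = refl
  coeff-· x (y ∷ p) (suc i) = coeff-· x p i

  -- Unlike Poly._≈_ (equality after trimming zeros), coefficientwise equality is
  -- a record, so Agda can read the two polynomials off an equation; ≋⇒≈ and ≈⇒≋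
  -- below show that the two agree.
  infix 4 _≋_
  record _≋_ (p p' : Pol) : Set where
    constructor coeffwise
    field coeff-≡ : ∀ i → coeff p i ≡ coeff p' i
  open _≋_

  ≋-refl : ∀ {p} → p ≋ p
  ≋-refl = coeffwise λ _ → refl

  ≋-sym : ∀ {p p'} → p ≋ p' → p' ≋ p
  ≋-sym e = coeffwise λ i → sym (coeff-≡ e i)

  ≋-trans : ∀ {p p' p''} → p ≋ p' → p' ≋ p'' → p ≋ p''
  ≋-trans e e' = coeffwise λ i → trans (coeff-≡ e i) (coeff-≡ e' i)

  ≋-setoid : Setoid 0ℓ 0ℓ
  ≋-setoid = record
    { Carrier = Pol ; _≈_ = _≋_
    ; isEquivalence = record { refl = ≋-refl ; sym = ≋-sym ; trans = ≋-trans } }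

  module ≋-Reasoning = Relation.Binary.Reasoning.Setoid ≋-setoid

  ∷-cong : ∀ {x y p p'} → x ≡ y → p ≋ p' → x ∷ p ≋ y ∷ p'
  ∷-cong x≡y e = coeffwise λ where
    zero    → x≡y
    (suc i) → coeff-≡ e i

  ∷-injectiveʳ : ∀ {x y p p'} → x ∷ p ≋ y ∷ p' → p ≋ p'
  ∷-injectiveʳ e = coeffwise λ i → coeff-≡ e (suc i)

  ∷-zero : ∀ {p} → p ≋ [] → 0# ∷ p ≋ []
  ∷-zero e = coeffwise λ where
    zero    → refl
    (suc i) → coeff-≡ e i

  ∷≋[]⇒≋[] : ∀ {x p} → x ∷ p ≋ [] → p ≋ []
  ∷≋[]⇒≋[] e = ∷-injectiveʳ (≋-trans e (≋-sym (∷-zero ≋-refl)))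

  module Laws where
    open ≡.≡-Reasoning

    +-cong : ∀ {p p' w w'} → p ≋ p' → w ≋ w' → p + w ≋ p' + w'
    +-cong {p} {p'} {w} {w'} e e' = coeffwise λ i → begin
      coeff (p + w) i             ≡⟨ coeff-+ p w i ⟩
      coeff p i +ᶠ coeff w i      ≡⟨ cong₂ _+ᶠ_ (coeff-≡ e i) (coeff-≡ e' i) ⟩
      coeff p' i +ᶠ coeff w' i    ≡⟨ coeff-+ p' w' i ⟨
      coeff (p' + w') i           ∎

    -‿cong : ∀ {p p'} → p ≋ p' → - p ≋ - p'
    -‿cong {p} {p'} e = coeffwise λ i →
      trans (coeff-neg p i) (trans (cong -ᶠ_ (coeff-≡ e i)) (sym (coeff-neg p' i)))

    ·-cong : ∀ {x y p p'} → x ≡ y → p ≋ p' → x · p ≋ y · p'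
    ·-cong {x} {y} {p} {p'} x≡y e = coeffwise λ i →
      trans (coeff-· x p i) (trans (cong₂ _*ᶠ_ x≡y (coeff-≡ e i)) (sym (coeff-· y p' i)))

    +-assoc : ∀ p w z → (p + w) + z ≋ p + (w + z)
    +-assoc p w z = coeffwise λ i → begin
      coeff ((p + w) + z) i                    ≡⟨ coeff-+ (p + w) z i ⟩
      coeff (p + w) i +ᶠ coeff z i             ≡⟨ cong (_+ᶠ coeff z i) (coeff-+ p w i) ⟩
      coeff p i +ᶠ coeff w i +ᶠ coeff z i      ≡⟨ 𝔽.+-assoc _ _ _ ⟩
      coeff p i +ᶠ (coeff w i +ᶠ coeff z i)    ≡⟨ cong (coeff p i +ᶠ_) (coeff-+ w z i) ⟨
      coeff p i +ᶠ coeff (w + z) i             ≡⟨ coeff-+ p (w + z) i ⟨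
      coeff (p + (w + z)) i                    ∎

    +-comm : ∀ p w → p + w ≋ w + p
    +-comm p w = coeffwise λ i →
      trans (coeff-+ p w i) (trans (𝔽.+-comm _ _) (sym (coeff-+ w p i)))

    +-identityˡ : ∀ p → [] + p ≋ p
    +-identityˡ p = ≋-refl

    +-identityʳ : ∀ p → p + [] ≋ p
    +-identityʳ p = coeffwise λ i → trans (coeff-+ p [] i) (𝔽.+-identityʳ _)

    -‿inverseˡ : ∀ p → - p + p ≋ []
    -‿inverseˡ p = coeffwise λ i → begin
      coeff (- p + p) i             ≡⟨ coeff-+ (- p) p i ⟩
      coeff (- p) i +ᶠ coeff p i    ≡⟨ cong (_+ᶠ coeff p i) (coeff-neg p i) ⟩
      -ᶠ coeff p i +ᶠ coeff p i     ≡⟨ 𝔽.-‿inverseˡ _ ⟩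
      0#                            ∎

    -‿inverseʳ : ∀ p → p + - p ≋ []
    -‿inverseʳ p = ≋-trans (+-comm p (- p)) (-‿inverseˡ p)

    +-interchange : ∀ p w z v → (p + w) + (z + v) ≋ (p + z) + (w + v)
    +-interchange p w z v = coeffwise λ i → begin
      coeff ((p + w) + (z + v)) i                          ≡⟨ coeff-+ (p + w) (z + v) i ⟩
      coeff (p + w) i +ᶠ coeff (z + v) i                   ≡⟨ cong₂ _+ᶠ_ (coeff-+ p w i) (coeff-+ z v i) ⟩
      (coeff p i +ᶠ coeff w i) +ᶠ (coeff z i +ᶠ coeff v i) ≡⟨ interchange _ _ _ _ ⟩
      (coeff p i +ᶠ coeff z i) +ᶠ (coeff w i +ᶠ coeff v i) ≡⟨ cong₂ _+ᶠ_ (coeff-+ p z i) (coeff-+ w v i) ⟨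
      coeff (p + z) i +ᶠ coeff (w + v) i                   ≡⟨ coeff-+ (p + z) (w + v) i ⟨
      coeff ((p + z) + (w + v)) i                          ∎
      where open import Algebra.Properties.CommutativeSemigroup 𝔽.+-commutativeSemigroup
              using (interchange)

    +-leftComm : ∀ p w z → p + (w + z) ≋ w + (p + z)
    +-leftComm p w z =
      ≋-trans (≋-sym (+-assoc p w z)) (≋-trans (+-cong (+-comm p w) ≋-refl) (+-assoc w p z))

    ·-distribʳ : ∀ x y p → (x +ᶠ y) · p ≋ x · p + y · p
    ·-distribʳ x y p = coeffwise λ i → begin
      coeff ((x +ᶠ y) · p) i                 ≡⟨ coeff-· (x +ᶠ y) p i ⟩
      (x +ᶠ y) *ᶠ coeff p i                  ≡⟨ 𝔽.distribʳ _ x y ⟩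
      x *ᶠ coeff p i +ᶠ y *ᶠ coeff p i       ≡⟨ cong₂ _+ᶠ_ (coeff-· x p i) (coeff-· y p i) ⟨
      coeff (x · p) i +ᶠ coeff (y · p) i     ≡⟨ coeff-+ (x · p) (y · p) i ⟨
      coeff (x · p + y · p) i                ∎

    ·-distribˡ : ∀ x p w → x · (p + w) ≋ x · p + x · w
    ·-distribˡ x p w = coeffwise λ i → begin
      coeff (x · (p + w)) i                  ≡⟨ coeff-· x (p + w) i ⟩
      x *ᶠ coeff (p + w) i                   ≡⟨ cong (x *ᶠ_) (coeff-+ p w i) ⟩
      x *ᶠ (coeff p i +ᶠ coeff w i)          ≡⟨ 𝔽.distribˡ x _ _ ⟩
      x *ᶠ coeff p i +ᶠ x *ᶠ coeff w i       ≡⟨ cong₂ _+ᶠ_ (coeff-· x p i) (coeff-· x w i) ⟨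
      coeff (x · p) i +ᶠ coeff (x · w) i     ≡⟨ coeff-+ (x · p) (x · w) i ⟨
      coeff (x · p + x · w) i                ∎

    ·-assoc : ∀ x y p → (x *ᶠ y) · p ≋ x · y · p
    ·-assoc x y p = coeffwise λ i → begin
      coeff ((x *ᶠ y) · p) i    ≡⟨ coeff-· (x *ᶠ y) p i ⟩
      x *ᶠ y *ᶠ coeff p i       ≡⟨ 𝔽.*-assoc x y _ ⟩
      x *ᶠ (y *ᶠ coeff p i)     ≡⟨ cong (x *ᶠ_) (coeff-· y p i) ⟨
      x *ᶠ coeff (y · p) i      ≡⟨ coeff-· x (y · p) i ⟨
      coeff (x · y · p) i       ∎

    ·-identityˡ : ∀ p → 1# · p ≋ p
    ·-identityˡ p = coeffwise λ i → trans (coeff-· 1# p i) (𝔽.*-identityˡ _)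

    ·-zeroˡ : ∀ p → 0# · p ≋ []
    ·-zeroˡ p = coeffwise λ i → trans (coeff-· 0# p i) (𝔽.zeroˡ _)

    *-congˡ : ∀ p {w w'} → w ≋ w' → p * w ≋ p * w'
    *-congˡ []      e = ≋-refl
    *-congˡ (x ∷ p) e = +-cong (·-cong refl e) (∷-cong refl (*-congˡ p e))

    *-zeroˡ : ∀ {p} w → p ≋ [] → p * w ≋ []
    *-zeroˡ {[]}    w e = ≋-refl
    *-zeroˡ {x ∷ p} w e =
      +-cong (≋-trans (·-cong (coeff-≡ e 0) ≋-refl) (·-zeroˡ w)) (∷-zero (*-zeroˡ w (∷≋[]⇒≋[] e)))

    *-zeroʳ : ∀ p → p * [] ≋ []
    *-zeroʳ []      = ≋-refl
    *-zeroʳ (x ∷ p) = ∷-zero (*-zeroʳ p)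

    *-congʳ : ∀ {p p'} w → p ≋ p' → p * w ≋ p' * w
    *-congʳ {[]}    {p'}     w e = ≋-sym (*-zeroˡ w (≋-sym e))
    *-congʳ {x ∷ p} {[]}     w e = *-zeroˡ w e
    *-congʳ {x ∷ p} {y ∷ p'} w e =
      +-cong (·-cong (coeff-≡ e 0) ≋-refl) (∷-cong refl (*-congʳ w (∷-injectiveʳ e)))

    *-distribʳ : ∀ w p p' → (p + p') * w ≋ p * w + p' * w
    *-distribʳ w []      p'       = ≋-refl
    *-distribʳ w (x ∷ p) []       = ≋-sym (+-identityʳ _)
    *-distribʳ w (x ∷ p) (y ∷ p') = ≋-trans
      (+-cong (·-distribʳ x y w) (∷-cong (sym (𝔽.+-identityˡ 0#)) (*-distribʳ w p p')))
      (+-interchange (x · w) (y · w) (0# ∷ p * w) (0# ∷ p' * w))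

    *-∷ʳ : ∀ p y w → p * (y ∷ w) ≋ y · p + (0# ∷ p * w)
    *-∷ʳ []      y w = ≋-sym (∷-zero ≋-refl)
    *-∷ʳ (x ∷ p) y w = ∷-cong (cong (_+ᶠ 0#) (𝔽.*-comm x y))
      (≋-trans (+-cong ≋-refl (*-∷ʳ p y w)) (+-leftComm (x · w) (y · p) (0# ∷ p * w)))

    *-comm : ∀ p w → p * w ≋ w * p
    *-comm []      w = ≋-sym (*-zeroʳ w)
    *-comm (x ∷ p) w = ≋-trans (+-cong ≋-refl (∷-cong refl (*-comm p w))) (≋-sym (*-∷ʳ w x p))

    ·-*-assoc : ∀ x p w → (x · p) * w ≋ x · (p * w)
    ·-*-assoc x []      w = ≋-refl
    ·-*-assoc x (y ∷ p) w = ≋-trans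
      (+-cong (·-assoc x y w) (∷-cong (sym (𝔽.zeroʳ x)) (·-*-assoc x p w)))
      (≋-sym (·-distribˡ x (y · w) (0# ∷ p * w)))

    *-assoc : ∀ p w z → (p * w) * z ≋ p * (w * z)
    *-assoc []      w z = ≋-refl
    *-assoc (x ∷ p) w z = ≋-trans (*-distribʳ z (x · w) (0# ∷ p * w))
      (+-cong (·-*-assoc x w z) (+-cong (·-zeroˡ z) (∷-cong refl (*-assoc p w z))))

    *-identityˡ : ∀ p → one * p ≋ p
    *-identityˡ p = ≋-trans (+-cong (·-identityˡ p) (∷-zero ≋-refl)) (+-identityʳ p)

    *-identityʳ : ∀ p → p * one ≋ p
    *-identityʳ p = ≋-trans (*-comm p one) (*-identityˡ p)

    *-distribˡ : ∀ w p p' → w * (p + p') ≋ w * p + w * p'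
    *-distribˡ w p p' =
      ≋-trans (*-comm w (p + p')) (≋-trans (*-distribʳ w p p') (+-cong (*-comm p w) (*-comm p' w)))

  𝔽[t] : CommutativeRing 0ℓ 0ℓ
  𝔽[t] = record
    { Carrier = Pol ; _≈_ = _≋_ ; _+_ = _+_ ; _*_ = _*_ ; -_ = -_ ; 0# = [] ; 1# = one
    ; isCommutativeRing = record
      { isRing = record
        { +-isAbelianGroup = record
          { isGroup = record
            { isMonoid = record
              { isSemigroup = record
                { isMagma = record
                  { isEquivalence = Setoid.isEquivalence ≋-setoid
                  ; ∙-cong = +-cong }
                ; assoc = +-assoc }
              ; identity = +-identityˡ , +-identityʳ }
            ; inverse = -‿inverseˡ , -‿inverseʳ
            ; ⁻¹-cong = -‿cong }
          ; comm = +-comm }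
        ; *-cong = λ {p} {p'} {w} e e' → ≋-trans (*-congʳ w e) (*-congˡ p' e')
        ; *-assoc = *-assoc
        ; *-identity = *-identityˡ , *-identityʳ
        ; distrib = *-distribˡ , *-distribʳ }
      ; *-comm = *-comm } }
    where open Laws

  open CommutativeRing 𝔽[t]
    using ( +-cong; +-congˡ; +-congʳ; +-comm; +-identityʳ; -‿cong; -‿inverseʳ
          ; *-cong; *-congˡ; *-congʳ; *-identityˡ; *-identityʳ; zeroˡ; zeroʳ )
  open IntegerCoefficientSolver 𝔽[t] using (solve; _:=_; _:+_; _:*_; _:-_)

  data Trimmed : Pol → Set where
    nil    : Trimmed []
    single : ∀ {x} → x ≢ 0# → Trimmed (x ∷ [])
    cons   : ∀ {x y ys} → Trimmed (y ∷ ys) → Trimmed (x ∷ y ∷ ys)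

  norm-trimmed : ∀ p → Trimmed (norm p)
  norm-trimmed []       = nil
  norm-trimmed (x ∷ xs) with norm xs | norm-trimmed xs
  ... | _ ∷ _ | t = cons t
  ... | []    | _ with x ≟ 0#
  ...   | yes _   = nil
  ...   | no  x≢0 = single x≢0

  norm-≋ : ∀ p → norm p ≋ p
  norm-≋ []       = ≋-refl
  norm-≋ (x ∷ xs) with norm xs | norm-≋ xs
  ... | _ ∷ _ | e = ∷-cong refl e
  ... | []    | e with x ≟ 0#
  ...   | yes x≡0 = ≋-sym (≋-trans (∷-cong x≡0 (≋-sym e)) (∷-zero ≋-refl))
  ...   | no  _   = ∷-cong refl e

  trimmed-nonzero : ∀ {y ys} → Trimmed (y ∷ ys) → ¬ y ∷ ys ≋ []
  trimmed-nonzero (single y≢0) e = y≢0 (coeff-≡ e 0)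
  trimmed-nonzero (cons t)     e = trimmed-nonzero t (∷≋[]⇒≋[] e)

  trimmed-≋⇒≡ : ∀ {p p'} → Trimmed p → Trimmed p' → p ≋ p' → p ≡ p'
  trimmed-≋⇒≡ nil        nil        e = refl
  trimmed-≋⇒≡ nil        (single t) e = ⊥-elim (trimmed-nonzero (single t) (≋-sym e))
  trimmed-≋⇒≡ nil        (cons t)   e = ⊥-elim (trimmed-nonzero (cons t) (≋-sym e))
  trimmed-≋⇒≡ (single t) nil        e = ⊥-elim (trimmed-nonzero (single t) e)
  trimmed-≋⇒≡ (cons t)   nil        e = ⊥-elim (trimmed-nonzero (cons t) e)
  trimmed-≋⇒≡ (single _) (single _) e = cong (_∷ []) (coeff-≡ e 0)
  trimmed-≋⇒≡ (single _) (cons t)   e = ⊥-elim (trimmed-nonzero t (≋-sym (∷-injectiveʳ e)))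
  trimmed-≋⇒≡ (cons t)   (single _) e = ⊥-elim (trimmed-nonzero t (∷-injectiveʳ e))
  trimmed-≋⇒≡ (cons t)   (cons t')  e = cong₂ _∷_ (coeff-≡ e 0) (trimmed-≋⇒≡ t t' (∷-injectiveʳ e))

  ≋⇒≈ : ∀ {p p'} → p ≋ p' → p ≈ p'
  ≋⇒≈ {p} {p'} e = trimmed-≋⇒≡ (norm-trimmed p) (norm-trimmed p')
    (≋-trans (norm-≋ p) (≋-trans e (≋-sym (norm-≋ p'))))

  ≈⇒≋ : ∀ {p p'} → p ≈ p' → p ≋ p'
  ≈⇒≋ {p} {p'} e = ≋-trans (≋-sym (norm-≋ p))
    (≋-trans (coeffwise λ i → cong (λ l → coeff l i) e) (norm-≋ p'))

  NonZeroP⇒≉ : ∀ {p} → NonZeroP p → ¬ p ≋ []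
  NonZeroP⇒≉ p≢0 = p≢0 ∘ ≋⇒≈

  Monic⇒≉0 : ∀ {g} → Monic g → ¬ g ≋ []
  Monic⇒≉0 monic g≋0 with () ← trans (sym (cong List.last (≋⇒≈ g≋0))) monic

  ∣-intro : ∀ {e f} k → e * k ≋ f → e ∣ f
  ∣-intro k ek≋f = k , ≋⇒≈ ek≋f

  record DegreeBelow (n : ℕ) (p : Pol) : Set where
    constructor vanishing
    field vanishes : ∀ i → n ℕ.≤ i → coeff p i ≡ 0#
  open DegreeBelow

  record HasDegree (p : Pol) (n : ℕ) : Set where
    constructor _,_
    field
      leading≢0 : coeff p n ≢ 0#
      below     : DegreeBelow (suc n) p
  open HasDegree

  DegreeBelow-mono : ∀ {m n p} → m ℕ.≤ n → DegreeBelow m p → DegreeBelow n p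
  DegreeBelow-mono m≤n b = vanishing λ i n≤i → vanishes b i (ℕ.≤-trans m≤n n≤i)

  DegreeBelow-∷ : ∀ {n x p} → DegreeBelow n p → DegreeBelow (suc n) (x ∷ p)
  DegreeBelow-∷ b = vanishing λ where (suc i) (s≤s n≤i) → vanishes b i n≤i

  DegreeBelow-∷⁻ : ∀ {n x p} → DegreeBelow (suc n) (x ∷ p) → DegreeBelow n p
  DegreeBelow-∷⁻ b = vanishing λ i n≤i → vanishes b (suc i) (s≤s n≤i)

  DegreeBelow-zero : ∀ {p} → DegreeBelow 0 p → p ≋ []
  DegreeBelow-zero b = coeffwise λ i → vanishes b i z≤n

  DegreeBelow-length : ∀ p → DegreeBelow (length p) p
  DegreeBelow-length []      = vanishing λ _ _ → refl
  DegreeBelow-length (x ∷ p) = DegreeBelow-∷ (DegreeBelow-length p)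

  DegreeBelow-resp-≋ : ∀ {n p p'} → p ≋ p' → DegreeBelow n p → DegreeBelow n p'
  DegreeBelow-resp-≋ e b = vanishing λ i n≤i → trans (sym (coeff-≡ e i)) (vanishes b i n≤i)

  DegreeBelow-+ : ∀ {n p w} → DegreeBelow n p → DegreeBelow n w → DegreeBelow n (p + w)
  DegreeBelow-+ {p = p} {w} bp bw = vanishing λ i n≤i →
    trans (coeff-+ p w i) (trans (cong₂ _+ᶠ_ (vanishes bp i n≤i) (vanishes bw i n≤i)) (𝔽.+-identityˡ 0#))

  DegreeBelow-· : ∀ {n} x {p} → DegreeBelow n p → DegreeBelow n (x · p)
  DegreeBelow-· x {p} b = vanishing λ i n≤i →
    trans (coeff-· x p i) (trans (cong (x *ᶠ_) (vanishes b i n≤i)) (𝔽.zeroʳ x))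

  DegreeBelow-≋ : ∀ {n p p'} → DegreeBelow n p → DegreeBelow n p' →
                  (∀ i → i ℕ.< n → coeff p i ≡ coeff p' i) → p ≋ p'
  DegreeBelow-≋ {n} bp bp' low = coeffwise λ i → case i ℕ.<? n of λ where
    (yes i<n) → low i i<n
    (no  i≮n) → trans (vanishes bp i (ℕ.≮⇒≥ i≮n)) (sym (vanishes bp' i (ℕ.≮⇒≥ i≮n)))

  HasDegree-resp-≋ : ∀ {n p p'} → p ≋ p' → HasDegree p n → HasDegree p' n
  HasDegree-resp-≋ {n} e (lead≢0 , b) =
    (λ lead≡0 → lead≢0 (trans (coeff-≡ e n) lead≡0)) , DegreeBelow-resp-≋ e b

  HasDegree-unique : ∀ {p m n} → HasDegree p m → HasDegree p n → m ≡ n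
  HasDegree-unique {m = m} {n} (lead≢0 , b) (lead'≢0 , b') with ℕ.<-cmp m n
  ... | tri< m<n _ _ = ⊥-elim (lead'≢0 (vanishes b n m<n))
  ... | tri≈ _ m≡n _ = m≡n
  ... | tri> _ _ n<m = ⊥-elim (lead≢0 (vanishes b' m n<m))

  HasDegree-nonzero : ∀ {p n} → HasDegree p n → ¬ p ≋ []
  HasDegree-nonzero {n = n} (lead≢0 , _) p≋[] = lead≢0 (coeff-≡ p≋[] n)

  HasDegree⇒< : ∀ {p n N} → HasDegree p n → DegreeBelow N p → n ℕ.< N
  HasDegree⇒< {n = n} {N} (lead≢0 , _) b with n ℕ.<? N
  ... | yes n<N = n<N
  ... | no  n≮N = ⊥-elim (lead≢0 (vanishes b n (ℕ.≮⇒≥ n≮N)))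

  HasDegree-∷ : ∀ {n x p} → HasDegree p n → HasDegree (x ∷ p) (suc n)
  HasDegree-∷ (lead≢0 , b) = lead≢0 , DegreeBelow-∷ b

  HasDegree-· : ∀ {n x p} → x ≢ 0# → HasDegree p n → HasDegree (x · p) n
  HasDegree-· {n} {x} {p} x≢0 (lead≢0 , b) =
    (λ lead≡0 → *-≢0 x≢0 lead≢0 (trans (sym (coeff-· x p n)) lead≡0)) , DegreeBelow-· x b

  HasDegree-+ˡ : ∀ {n p w} → DegreeBelow n w → HasDegree p n → HasDegree (w + p) n
  HasDegree-+ˡ {n} {p} {w} bw (lead≢0 , b) =
    (λ lead≡0 → lead≢0 (trans (sym leading-coeff) lead≡0)) ,
    DegreeBelow-+ (DegreeBelow-mono (ℕ.n≤1+n n) bw) b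
    where
    leading-coeff : coeff (w + p) n ≡ coeff p n
    leading-coeff =
      trans (coeff-+ w p n) (trans (cong (_+ᶠ coeff p n) (vanishes bw n ℕ.≤-refl)) (𝔽.+-identityˡ _))

  HasDegree-* : ∀ {p w m n} → HasDegree p m → HasDegree w n → HasDegree (p * w) (m ℕ.+ n)
  HasDegree-* {[]}    (lead≢0 , _) _ = ⊥-elim (lead≢0 refl)
  HasDegree-* {x ∷ p} {w} {zero} (x≢0 , b) w-deg =
    HasDegree-resp-≋ (≋-sym (≋-trans (+-congˡ shifted≋0) (+-identityʳ (x · w)))) (HasDegree-· x≢0 w-deg)
    where
    shifted≋0 : 0# ∷ p * w ≋ []
    shifted≋0 = ∷-zero (≋-trans (*-congʳ (DegreeBelow-zero (DegreeBelow-∷⁻ b))) (zeroˡ w))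
  HasDegree-* {x ∷ p} {w} {suc m} {n} (lead≢0 , b) w-deg =
    HasDegree-+ˡ (DegreeBelow-mono (s≤s (ℕ.m≤n+m n m)) (DegreeBelow-· x (below w-deg)))
      (HasDegree-∷ (HasDegree-* {p} (lead≢0 , DegreeBelow-∷⁻ b) w-deg))

  trimmed-HasDegree : ∀ {y ys} → Trimmed (y ∷ ys) → HasDegree (y ∷ ys) (length ys)
  trimmed-HasDegree (single y≢0) = y≢0 , DegreeBelow-length (_ ∷ [])
  trimmed-HasDegree (cons t)     = HasDegree-∷ (trimmed-HasDegree t)

  nonzero⇒HasDegree : ∀ {p} → ¬ p ≋ [] → HasDegree p (deg p)
  nonzero⇒HasDegree {p} p≉0 with norm p | norm-trimmed p | norm-≋ p
  ... | []    | _ | norm≋p = ⊥-elim (p≉0 (≋-sym norm≋p))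
  ... | _ ∷ _ | t | norm≋p = HasDegree-resp-≋ norm≋p (trimmed-HasDegree t)

  zero-or-HasDegree : ∀ p → p ≋ [] ⊎ HasDegree p (deg p)
  zero-or-HasDegree p with List.≡-dec _≟_ (norm p) []
  ... | yes p≈[] = inj₁ (≈⇒≋ p≈[])
  ... | no  p≢0  = inj₂ (nonzero⇒HasDegree (NonZeroP⇒≉ p≢0))

  *-nonzero : ∀ {p w} → ¬ p ≋ [] → ¬ w ≋ [] → ¬ p * w ≋ []
  *-nonzero p≉0 w≉0 = HasDegree-nonzero (HasDegree-* (nonzero⇒HasDegree p≉0) (nonzero⇒HasDegree w≉0))

  deg-cong : ∀ {p p'} → p ≋ p' → deg p ≡ deg p'
  deg-cong e = cong (λ l → length l ℕ.∸ 1) (≋⇒≈ e)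

  deg-* : ∀ {p w} → ¬ p ≋ [] → ¬ w ≋ [] → deg (p * w) ≡ deg p ℕ.+ deg w
  deg-* p≉0 w≉0 = HasDegree-unique (nonzero⇒HasDegree (*-nonzero p≉0 w≉0))
    (HasDegree-* (nonzero⇒HasDegree p≉0) (nonzero⇒HasDegree w≉0))

  *-cancelˡ : ∀ {h p p'} → ¬ h ≋ [] → h * p ≋ h * p' → p ≋ p'
  *-cancelˡ {h} {p} {p'} h≉0 hp≋hp' with zero-or-HasDegree (p - p')
  ... | inj₁ p-p'≋0 = begin
    p               ≈⟨ solve 2 (λ p p' → p := (p :- p') :+ p') ≋-refl p p' ⟩
    (p - p') + p'   ≈⟨ +-congʳ p-p'≋0 ⟩
    [] + p'         ≡⟨⟩
    p'              ∎
    where open ≋-Reasoning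
  ... | inj₂ p-p'-deg = ⊥-elim (HasDegree-nonzero (HasDegree-* (nonzero⇒HasDegree h≉0) p-p'-deg) (begin
    h * (p - p')      ≈⟨ solve 3 (λ h p p' → h :* (p :- p') := h :* p :- h :* p') ≋-refl h p p' ⟩
    h * p - h * p'    ≈⟨ +-congʳ hp≋hp' ⟩
    h * p' - h * p'   ≈⟨ -‿inverseʳ (h * p') ⟩
    []                ∎))
    where open ≋-Reasoning

  ∣⇒deg≤ : ∀ {e f} → e ∣ f → ¬ f ≋ [] → deg e ℕ.≤ deg f
  ∣⇒deg≤ {e} {f} (k , ek≈f) f≉0 = begin
    deg e             ≤⟨ ℕ.m≤m+n (deg e) (deg k) ⟩
    deg e ℕ.+ deg k   ≡⟨ deg-* e≉0 k≉0 ⟨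
    deg (e * k)       ≡⟨ deg-cong ek≋f ⟩
    deg f             ∎
    where
    open ℕ.≤-Reasoning
    ek≋f : e * k ≋ f
    ek≋f = ≈⇒≋ ek≈f
    e≉0 : ¬ e ≋ []
    e≉0 e≋0 = f≉0 (≋-trans (≋-sym ek≋f) (≋-trans (*-congʳ e≋0) (zeroˡ k)))
    k≉0 : ¬ k ≋ []
    k≉0 k≋0 = f≉0 (≋-trans (≋-sym ek≋f) (≋-trans (*-congˡ {e} k≋0) (zeroʳ e)))

  leading-term-cancel : ∀ {m n g} → HasDegree m n → DegreeBelow (suc n) g →
                        ∃ λ c → DegreeBelow n (g - c · m)
  leading-term-cancel {m} {n} {g} (lead≢0 , m-below) g-below with inverse (coeff m n) lead≢0
  ... | lead⁻¹ , lead·lead⁻¹≡1 = c , vanishing vanish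
    where
    open ≡.≡-Reasoning
    open import Algebra.Properties.Group 𝔽.+-group using (ε⁻¹≈ε)
    c : Carrier
    c = coeff g n *ᶠ lead⁻¹
    coeff-diff : ∀ i → coeff (g - c · m) i ≡ coeff g i +ᶠ -ᶠ (c *ᶠ coeff m i)
    coeff-diff i = trans (coeff-+ g (- (c · m)) i)
      (cong (coeff g i +ᶠ_) (trans (coeff-neg (c · m) i) (cong -ᶠ_ (coeff-· c m i))))
    c·lead≡ : c *ᶠ coeff m n ≡ coeff g n
    c·lead≡ = begin
      coeff g n *ᶠ lead⁻¹ *ᶠ coeff m n     ≡⟨ 𝔽.*-assoc _ _ _ ⟩
      coeff g n *ᶠ (lead⁻¹ *ᶠ coeff m n)   ≡⟨ cong (coeff g n *ᶠ_) (trans (𝔽.*-comm _ _) lead·lead⁻¹≡1) ⟩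
      coeff g n *ᶠ 1#                      ≡⟨ 𝔽.*-identityʳ _ ⟩
      coeff g n                            ∎
    vanish : ∀ i → n ℕ.≤ i → coeff (g - c · m) i ≡ 0#
    vanish i n≤i with ℕ.m≤n⇒m<n∨m≡n n≤i
    ... | inj₂ refl = begin
      coeff (g - c · m) n                ≡⟨ coeff-diff n ⟩
      coeff g n +ᶠ -ᶠ (c *ᶠ coeff m n)   ≡⟨ cong (λ z → coeff g n +ᶠ -ᶠ z) c·lead≡ ⟩
      coeff g n +ᶠ -ᶠ coeff g n          ≡⟨ 𝔽.-‿inverseʳ _ ⟩
      0#                                 ∎
    ... | inj₁ n<i = begin
      coeff (g - c · m) i                ≡⟨ coeff-diff i ⟩
      coeff g i +ᶠ -ᶠ (c *ᶠ coeff m i)   ≡⟨ cong₂ (λ a b → a +ᶠ -ᶠ (c *ᶠ b)) (vanishes g-below i n<i) (vanishes m-below i n<i) ⟩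
      0# +ᶠ -ᶠ (c *ᶠ 0#)                 ≡⟨ 𝔽.+-identityˡ _ ⟩
      -ᶠ (c *ᶠ 0#)                       ≡⟨ cong -ᶠ_ (𝔽.zeroʳ c) ⟩
      -ᶠ 0#                              ≡⟨ ε⁻¹≈ε ⟩
      0#                                 ∎

  divide : ∀ {m n} → HasDegree m n → ∀ f → ∃ λ Q → DegreeBelow n (f - Q * m)
  divide m-deg []      = [] , vanishing λ _ _ → refl
  divide {m} m-deg (x ∷ f) with divide m-deg f
  ... | Q , remainder-below with leading-term-cancel m-deg (DegreeBelow-∷ {x = x +ᶠ -ᶠ 0#} remainder-below)
  ...   | c , remainder-below' = c ∷ Q , DegreeBelow-resp-≋ rearrange remainder-below'
    where
    rearrange : ((x ∷ f) - (0# ∷ Q * m)) - c · m ≋ (x ∷ f) - (c · m + (0# ∷ Q * m))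
    rearrange = solve 3 (λ f A B → (f :- B) :- A := f :- (A :+ B)) ≋-refl (x ∷ f) (c · m) (0# ∷ Q * m)

  record Bezout (f f' : Pol) : Set where
    field
      gcd x y  : Pol
      identity : gcd ≋ x * f + y * f'
      gcd∣f    : gcd ∣ f
      gcd∣f'   : gcd ∣ f'

  bezout-zero : ∀ f f' → f' ≋ [] → Bezout f f'
  bezout-zero f f' f'≋0 = record
    { gcd = f ; x = one ; y = []
    ; identity = ≋-sym (≋-trans (+-identityʳ (one * f)) (*-identityˡ f))
    ; gcd∣f    = ∣-intro {f} one (*-identityʳ f)
    ; gcd∣f'   = ∣-intro {f} [] (≋-trans (zeroʳ f) (≋-sym f'≋0)) }

  bezout-step : ∀ f f' Q → Bezout f' (f - Q * f') → Bezout f f'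
  bezout-step f f' Q B = record
    { gcd = h ; x = y ; y = x - y * Q
    ; identity = ≋-trans identity
        (solve 5 (λ x y f f' Q → x :* f' :+ y :* (f :- Q :* f') := y :* f :+ (x :- y :* Q) :* f') ≋-refl x y f f' Q)
    ; gcd∣f    = ∣-intro {h} (Q * k₁ + k₂) (begin
        h * (Q * k₁ + k₂)       ≈⟨ solve 4 (λ h Q k₁ k₂ → h :* (Q :* k₁ :+ k₂) := Q :* (h :* k₁) :+ h :* k₂) ≋-refl h Q k₁ k₂ ⟩
        Q * (h * k₁) + h * k₂   ≈⟨ +-cong (*-congˡ {Q} hk₁≋f') hk₂≋r ⟩
        Q * f' + (f - Q * f')   ≈⟨ solve 3 (λ Q f' f → Q :* f' :+ (f :- Q :* f') := f) ≋-refl Q f' f ⟩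
        f                       ∎)
    ; gcd∣f'   = gcd∣f }
    where
    open Bezout B renaming (gcd to h; gcd∣f' to gcd∣r)
    open ≋-Reasoning
    k₁ k₂ : Pol
    k₁ = proj₁ gcd∣f
    k₂ = proj₁ gcd∣r
    hk₁≋f' : h * k₁ ≋ f'
    hk₁≋f' = ≈⇒≋ (proj₂ gcd∣f)
    hk₂≋r : h * k₂ ≋ f - Q * f'
    hk₂≋r = ≈⇒≋ (proj₂ gcd∣r)

  bezout-below : ∀ N f f' → DegreeBelow N f' → Bezout f f'
  bezout-below N f f' b with zero-or-HasDegree f'
  ... | inj₁ f'≋0 = bezout-zero f f' f'≋0
  ... | inj₂ f'-deg with N | HasDegree⇒< f'-deg b
  ...   | suc N | s≤s deg≤N with divide f'-deg f
  ...     | Q , remainder-below =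
    bezout-step f f' Q (bezout-below N f' (f - Q * f') (DegreeBelow-mono deg≤N remainder-below))

  bezout : ∀ f f' → Bezout f f'
  bezout f f' = bezout-below (length f') f f' (DegreeBelow-length f')

  IsMonicGCD⇒combination : ∀ {f f' g} → IsMonicGCD f f' g → ∃₂ λ x y → g ≋ x * f + y * f'
  IsMonicGCD⇒combination {f} {f'} {g} (_ , _ , _ , greatest) =
    let k , gcd·k≈g = greatest gcd gcd∣f gcd∣f' in
    k * x , k * y , (begin
      g                        ≈⟨ ≈⇒≋ gcd·k≈g ⟨
      gcd * k                  ≈⟨ *-congʳ identity ⟩
      (x * f + y * f') * k     ≈⟨ solve 5 (λ x y f f' k → (x :* f :+ y :* f') :* k := k :* x :* f :+ k :* y :* f') ≋-refl x y f f' k ⟩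
      k * x * f + k * y * f'   ∎)
    where
    open Bezout (bezout f f')
    open ≋-Reasoning

  coprime-divisor : ∀ {e f c} x y → one ≋ x * f + y * e → e ∣ (f * c) → e ∣ c
  coprime-divisor {e} {f} {c} x y one≋ (k , ek≈fc) = ∣-intro {e} (x * k + y * c) (begin
    e * (x * k + y * c)       ≈⟨ solve 5 (λ e x k y c → e :* (x :* k :+ y :* c) := x :* (e :* k) :+ y :* e :* c) ≋-refl e x k y c ⟩
    x * (e * k) + y * e * c   ≈⟨ +-congʳ (*-congˡ {x} (≈⇒≋ ek≈fc)) ⟩
    x * (f * c) + y * e * c   ≈⟨ solve 5 (λ x f c y e → x :* (f :* c) :+ y :* e :* c := (x :* f :+ y :* e) :* c) ≋-refl x f c y e ⟩
    (x * f + y * e) * c       ≈⟨ *-congʳ one≋ ⟨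
    one * c                   ≈⟨ *-identityˡ c ⟩
    c                         ∎)
    where open ≋-Reasoning

  index-injective : ∀ {x y} → index (complete x) ≡ index (complete y) → x ≡ y
  index-injective {x} {y} eq = trans (lookup-index (complete x))
    (trans (cong (List.lookup elements) eq) (sym (lookup-index (complete y))))

  coeff-drop : ∀ p i → coeff (List.drop 1 p) i ≡ coeff p (suc i)
  coeff-drop []      i = refl
  coeff-drop (x ∷ p) i = refl

  digits : (n : ℕ) → Pol → Fin (q ^ n)
  digits zero    p = Fin.zero
  digits (suc n) p = Fin.combine (index (complete (coeff p 0))) (digits n (List.drop 1 p))

  digits-injective : ∀ n {p p'} → digits n p ≡ digits n p' → ∀ i → i ℕ.< n → coeff p i ≡ coeff p' i
  digits-injective (suc n) {p} {p'} eq i i<n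
    with Fin.combine-injective (index (complete (coeff p 0))) (digits n (List.drop 1 p))
                               (index (complete (coeff p' 0))) (digits n (List.drop 1 p')) eq
  digits-injective (suc n) {p} {p'} eq zero    _         | head≡ , _     = index-injective head≡
  digits-injective (suc n) {p} {p'} eq (suc i) (s≤s i<n) | _     , tail≡ =
    trans (sym (coeff-drop p i)) (trans (digits-injective n tail≡ i i<n) (coeff-drop p' i))

  -- a = a₀ + s₁ w is coded by the remainder of w modulo h; equal codes make
  -- w ≡ w' modulo h, hence a ≡ a' modulo s = h s₁.
  congruent-classes-length≤ : ∀ {s h s₁ a₀ n L} → HasDegree h n → h * s₁ ≋ s →
    All (λ a → s₁ ∣ (a - a₀)) L → AllPairs (λ a a' → ¬ s ∣ (a - a')) L → length L ℕ.≤ q ^ n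
  congruent-classes-length≤ {s} {h} {s₁} {a₀} {n} h-deg hs₁≋s =
    separated-length≤ {P = λ a → s₁ ∣ (a - a₀)} {R = λ a a' → ¬ s ∣ (a - a')}
      (λ {a} → code {a}) (λ {a} {a'} → separates {a} {a'})
    where
    quotient remainder : Pol → Pol
    quotient w  = proj₁ (divide h-deg w)
    remainder w = w - quotient w * h

    code : ∀ {a} → s₁ ∣ (a - a₀) → Fin (q ^ n)
    code (w , _) = digits n (remainder w)

    separates : ∀ {a a'} (pa : s₁ ∣ (a - a₀)) (pa' : s₁ ∣ (a' - a₀)) →
                code {a} pa ≡ code {a'} pa' → ¬ ¬ s ∣ (a - a')
    separates {a} {a'} (w , s₁w≈) (w' , s₁w'≈) same-digits s∤a-a' =
      s∤a-a' (∣-intro {s} (Q - Q') (begin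
        s * (Q - Q')                            ≈⟨ *-congʳ hs₁≋s ⟨
        h * s₁ * (Q - Q')                       ≈⟨ solve 5 (λ h s₁ Q Q' w' → h :* s₁ :* (Q :- Q') := s₁ :* (w' :- Q' :* h :+ Q :* h) :- s₁ :* w') ≋-refl h s₁ Q Q' w' ⟩
        s₁ * (remainder w' + Q * h) - s₁ * w'   ≈⟨ +-congʳ (*-congˡ {s₁} (+-congʳ (≋-sym same-remainder))) ⟩
        s₁ * (remainder w + Q * h) - s₁ * w'    ≈⟨ +-congʳ (*-congˡ {s₁} (solve 3 (λ w Q h → w :- Q :* h :+ Q :* h := w) ≋-refl w Q h)) ⟩
        s₁ * w - s₁ * w'                        ≈⟨ +-cong s₁w≋ (-‿cong s₁w'≋) ⟩
        (a - a₀) - (a' - a₀)                    ≈⟨ solve 3 (λ a a' a₀ → (a :- a₀) :- (a' :- a₀) := a :- a') ≋-refl a a' a₀ ⟩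
        a - a'                                  ∎))
      where
      open ≋-Reasoning
      Q Q' : Pol
      Q  = quotient w
      Q' = quotient w'
      s₁w≋ : s₁ * w ≋ a - a₀
      s₁w≋ = ≈⇒≋ s₁w≈
      s₁w'≋ : s₁ * w' ≋ a' - a₀
      s₁w'≋ = ≈⇒≋ s₁w'≈
      same-remainder : remainder w ≋ remainder w'
      same-remainder = DegreeBelow-≋ (proj₂ (divide h-deg w)) (proj₂ (divide h-deg w'))
        (digits-injective n {remainder w} {remainder w'} same-digits)

  record GcdFactorisation (s d : Pol) : Set where
    field
      h s₁ d₁ α δ       : Pol
      h≉0               : ¬ h ≋ []
      h*s₁≋s            : h * s₁ ≋ s
      h*d₁≋d            : h * d₁ ≋ d
      cofactors-coprime : one ≋ α * s₁ + δ * d₁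

  gcdFactorisation : ∀ {s} d → ¬ s ≋ [] → GcdFactorisation s d
  gcdFactorisation {s} d s≉0 = record
    { h = gcd ; s₁ = s₁ ; d₁ = d₁ ; α = x ; δ = y
    ; h≉0 = h≉0 ; h*s₁≋s = h*s₁≋s ; h*d₁≋d = h*d₁≋d
    ; cofactors-coprime = *-cancelˡ h≉0 (begin
        gcd * one                         ≈⟨ *-identityʳ gcd ⟩
        gcd                               ≈⟨ identity ⟩
        x * s + y * d                     ≈⟨ +-cong (*-congˡ {x} h*s₁≋s) (*-congˡ {y} h*d₁≋d) ⟨
        x * (gcd * s₁) + y * (gcd * d₁)   ≈⟨ solve 5 (λ x h s₁ y d₁ → x :* (h :* s₁) :+ y :* (h :* d₁) := h :* (x :* s₁ :+ y :* d₁)) ≋-refl x gcd s₁ y d₁ ⟩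
        gcd * (x * s₁ + y * d₁)           ∎) }
    where
    open Bezout (bezout s d)
    open ≋-Reasoning
    s₁ d₁ : Pol
    s₁ = proj₁ gcd∣f
    d₁ = proj₁ gcd∣f'
    h*s₁≋s : gcd * s₁ ≋ s
    h*s₁≋s = ≈⇒≋ (proj₂ gcd∣f)
    h*d₁≋d : gcd * d₁ ≋ d
    h*d₁≋d = ≈⇒≋ (proj₂ gcd∣f')
    h≉0 : ¬ gcd ≋ []
    h≉0 h≋0 = s≉0 (≋-trans (≋-sym h*s₁≋s) (≋-trans (*-congʳ h≋0) (zeroˡ s₁)))

  -- eq₀ says a₀/s + b/r = u₀/d.
  module Denominators {s d r : Pol} (G : GcdFactorisation s d) (r≉0 : ¬ r ≋ []) (b a₀ u₀ : Pol)
                      (eq₀ : u₀ * (r * s) ≋ (a₀ * r + b * s) * d) where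
    open GcdFactorisation G

    s₁∣a-a₀ : ∀ a u → u * (r * s) ≋ (a * r + b * s) * d → s₁ ∣ (a - a₀)
    s₁∣a-a₀ a u eq =
      coprime-divisor {s₁} {d₁} {a - a₀} δ α (≋-trans cofactors-coprime (+-comm (α * s₁) (δ * d₁)))
        (∣-intro {s₁} (u - u₀) (*-cancelˡ (*-nonzero h≉0 r≉0) (begin
          h * r * (s₁ * (u - u₀))                     ≈⟨ solve 5 (λ h r s₁ u u₀ → h :* r :* (s₁ :* (u :- u₀)) := u :* (r :* (h :* s₁)) :- u₀ :* (r :* (h :* s₁))) ≋-refl h r s₁ u u₀ ⟩
          u * (r * (h * s₁)) - u₀ * (r * (h * s₁))    ≈⟨ +-cong (*-congˡ {u} (*-congˡ {r} h*s₁≋s)) (-‿cong (*-congˡ {u₀} (*-congˡ {r} h*s₁≋s))) ⟩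
          u * (r * s) - u₀ * (r * s)                  ≈⟨ +-cong eq (-‿cong eq₀) ⟩
          (a * r + b * s) * d - (a₀ * r + b * s) * d  ≈⟨ solve 6 (λ a a₀ r b s d → (a :* r :+ b :* s) :* d :- (a₀ :* r :+ b :* s) :* d := r :* (a :- a₀) :* d) ≋-refl a a₀ r b s d ⟩
          r * (a - a₀) * d                            ≈⟨ *-congˡ {r * (a - a₀)} h*d₁≋d ⟨
          r * (a - a₀) * (h * d₁)                     ≈⟨ solve 5 (λ r a a₀ h d₁ → r :* (a :- a₀) :* (h :* d₁) := h :* r :* (d₁ :* (a :- a₀))) ≋-refl r a a₀ h d₁ ⟩
          h * r * (d₁ * (a - a₀))                     ∎)))
      where open ≋-Reasoning

    length≤ : ∀ {L} → AllPairs (λ a a' → ¬ s ∣ (a - a')) L →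
              All (λ a → Denom (a * r + b * s) (r * s) d) L → length L ℕ.≤ q ^ deg h
    length≤ incongruent denominators = congruent-classes-length≤ (nonzero⇒HasDegree h≉0) h*s₁≋s
      (All.map (λ {a} → λ { (_ , u , eq , _) → s₁∣a-a₀ a u (≈⇒≋ eq) }) denominators) incongruent

    r∣s*d₁ : IsMonicGCD b r one → r ∣ (s * d₁)
    r∣s*d₁ b⊥r =
      let β , ρ , one≋ = IsMonicGCD⇒combination {b} {r} b⊥r in
      coprime-divisor {r} {b} {s * d₁} β ρ one≋ (∣-intro {r} (u₀ * s₁ - a₀ * d₁) (*-cancelˡ h≉0 (begin
        h * (r * (u₀ * s₁ - a₀ * d₁))             ≈⟨ solve 6 (λ h r u₀ s₁ a₀ d₁ → h :* (r :* (u₀ :* s₁ :- a₀ :* d₁)) := u₀ :* (r :* (h :* s₁)) :- a₀ :* r :* (h :* d₁)) ≋-refl h r u₀ s₁ a₀ d₁ ⟩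
        u₀ * (r * (h * s₁)) - a₀ * r * (h * d₁)   ≈⟨ +-cong (*-congˡ {u₀} (*-congˡ {r} h*s₁≋s)) (-‿cong (*-congˡ {a₀ * r} h*d₁≋d)) ⟩
        u₀ * (r * s) - a₀ * r * d                 ≈⟨ +-congʳ eq₀ ⟩
        (a₀ * r + b * s) * d - a₀ * r * d         ≈⟨ solve 5 (λ a₀ r b s d → (a₀ :* r :+ b :* s) :* d :- a₀ :* r :* d := b :* s :* d) ≋-refl a₀ r b s d ⟩
        b * s * d                                 ≈⟨ *-congˡ {b * s} h*d₁≋d ⟨
        b * s * (h * d₁)                          ≈⟨ solve 4 (λ b s h d₁ → b :* s :* (h :* d₁) := h :* (b :* (s :* d₁))) ≋-refl b s h d₁ ⟩
        h * (b * (s * d₁))                        ∎)))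
      where open ≋-Reasoning

    r*h∣d*g : ∀ {g} → IsMonicGCD b r one → IsMonicGCD r s g → (r * h) ∣ (d * g)
    r*h∣d*g {g} b⊥r r⊓s =
      let x , y , g≋ = IsMonicGCD⇒combination {r} {s} {g} r⊓s
          k , rk≈sd₁ = r∣s*d₁ b⊥r
      in ∣-intro {r * h} (x * d₁ + y * k) (begin
        r * h * (x * d₁ + y * k)              ≈⟨ solve 6 (λ r h x d₁ y k → r :* h :* (x :* d₁ :+ y :* k) := h :* d₁ :* (x :* r) :+ h :* y :* (r :* k)) ≋-refl r h x d₁ y k ⟩
        h * d₁ * (x * r) + h * y * (r * k)    ≈⟨ +-congˡ (*-congˡ {h * y} (≈⇒≋ rk≈sd₁)) ⟩
        h * d₁ * (x * r) + h * y * (s * d₁)   ≈⟨ solve 6 (λ h d₁ x r y s → h :* d₁ :* (x :* r) :+ h :* y :* (s :* d₁) := h :* d₁ :* (x :* r :+ y :* s)) ≋-refl h d₁ x r y s ⟩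
        h * d₁ * (x * r + y * s)              ≈⟨ *-cong h*d₁≋d (≋-sym g≋) ⟩
        d * g                                 ∎)
      where open ≋-Reasoning

    degree-bound : ∀ {g} → ¬ d ≋ [] → IsMonicGCD b r one → IsMonicGCD r s g →
                   deg h ℕ.+ deg r ℕ.≤ deg d ℕ.+ deg g
    degree-bound {g} d≉0 b⊥r r⊓s = begin
      deg h ℕ.+ deg r   ≡⟨ ℕ.+-comm (deg h) (deg r) ⟩
      deg r ℕ.+ deg h   ≡⟨ deg-* r≉0 h≉0 ⟨
      deg (r * h)       ≤⟨ ∣⇒deg≤ {r * h} {d * g} (r*h∣d*g b⊥r r⊓s) (*-nonzero d≉0 (Monic⇒≉0 (proj₁ r⊓s))) ⟩
      deg (d * g)       ≡⟨ deg-* d≉0 (Monic⇒≉0 (proj₁ r⊓s)) ⟩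
      deg d ℕ.+ deg g   ∎
      where open ℕ.≤-Reasoning

lemma6p1 : (F : FiniteField) → let open Poly F in
    (d r s b : Pol) → NonZeroP d → NonZeroP r → NonZeroP s →
    IsMonicGCD b r one →
    (g : Pol) → IsMonicGCD r s g →
    (L : List Pol) →
    AllPairs (λ a a' → ¬ (s ∣ (a - a'))) L →
    All (λ a → Denom (a * r + b * s) (r * s) d) L →
    length L *ℕ ⟨ r ⟩ ≤ ⟨ d ⟩ *ℕ ⟨ g ⟩
lemma6p1 F d r s b d≢0 r≢0 s≢0 b⊥r g r⊓s []         _           _            = z≤n
lemma6p1 F d r s b d≢0 r≢0 s≢0 b⊥r g r⊓s L@(a₀ ∷ _) incongruent denominators@((_ , u₀ , eq₀ , _) ∷ _) =
  begin
    length L *ℕ q ^ deg r     ≤⟨ ℕ.*-monoˡ-≤ (q ^ deg r) (length≤ incongruent denominators) ⟩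
    q ^ deg h *ℕ q ^ deg r    ≡⟨ ℕ.^-distribˡ-+-* q (deg h) (deg r) ⟨
    q ^ (deg h ℕ.+ deg r)     ≤⟨ ℕ.^-monoʳ-≤ q ⦃ q-nonZero ⦄ (degree-bound {g} (NonZeroP⇒≉ d≢0) b⊥r r⊓s) ⟩
    q ^ (deg d ℕ.+ deg g)     ≡⟨ ℕ.^-distribˡ-+-* q (deg d) (deg g) ⟩
    q ^ deg d *ℕ q ^ deg g    ∎
  where
  open Poly F
  open FiniteField F using (q)
  open FqPolynomials F
  open ℕ.≤-Reasoning
  G : GcdFactorisation s d
  G = gcdFactorisation d (NonZeroP⇒≉ s≢0)
  open GcdFactorisation G using (h)
  open Denominators G (NonZeroP⇒≉ r≢0) b a₀ u₀ (≈⇒≋ eq₀)
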